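{- The min-max-removal game on any colored skew Young diagram poset without blocking triples is balanced.
   Context: A Young diagram is a finite collection of cells in left-justified rows with weakly decreasing row lengths (English notation); a skew Young diagram is a Young diagram with a smaller Young diagram deleted from its upper-left corner. It is regarded as a poset in which a cell covers the cell immediately to its left and the cell immediately above it (when these exist in the diagram). A colored poset has each element colored black or white. A blocking triple is a triple $x\lessdot y\lessdot z$ (each a covering relation) with $x,y$ of the same color and $z$ of a different color. The min-max-removal game on a colored finite poset: White and Black alternately remove an element of their own color that is maximal or minimal in the remaining subposet; a player who cannot move loses. A position (a remaining set of elements with induced order and coloring) is balanced if (i) every position reachable from it in one move (by either player) is balanced, and (ii) whenever all its removable elements (here: elements maximal or minimal in the position) are of the same color, at least half of its elements have that color. -}

module Defs where

open import Data.Nat using (ℕ; zero; suc; _+_; _*_; _∸_; _≤_; _<_)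
open import Data.Bool using (Bool; true; false; not)
open import Data.Product using (_×_; _,_; Σ; ∃)
open import Data.List using (List; []; _∷_; length; map; concatMap; upTo; filter)
open import Data.List.Membership.Propositional using (_∈_)
open import Relation.Binary.PropositionalEquality using (_≡_; _≢_)
open import Relation.Binary.Construct.Closure.Transitive using (TransClosure)
open import Relation.Nullary using (¬_)
open import Relation.Nullary.Decidable using (¬?)
open import Data.Bool.Properties using () renaming (_≟_ to _≟ᵇ_)
open import Data.Product.Properties using (≡-dec)
open import Data.Nat.Properties using () renaming (_≟_ to _≟ℕ_)

-- A cell (i , j) : row i, column j (English notation, 0-indexed).
Cell : Set
Cell = ℕ × ℕ

row : List ℕ → ℕ → ℕ
row []       _       = 0
row (x ∷ xs) zero    = x
row (x ∷ xs) (suc i) = row xs i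

IsPartition : List ℕ → Set
IsPartition la = ∀ i → row la (suc i) ≤ row la i

_⊆Y_ : List ℕ → List ℕ → Set
mu ⊆Y la = ∀ i → row mu i ≤ row la i

InSkew : List ℕ → List ℕ → Cell → Set
InSkew la mu (i , j) = (row mu i ≤ j) × (j < row la i)

range : ℕ → ℕ → List ℕ
range a b = map (a +_) (upTo (b ∸ a))

skewCells : List ℕ → List ℕ → List Cell
skewCells la mu = concatMap (λ i → map (i ,_) (range (row mu i) (row la i))) (upTo (length la))

data Adj : Cell → Cell → Set where
  left  : ∀ i j → Adj (i , j) (i , suc j)
  above : ∀ i j → Adj (i , j) (suc i , j)

Covers : List ℕ → List ℕ → Cell → Cell → Set
Covers la mu x y = InSkew la mu x × InSkew la mu y × Adj x y

_<[_,_]_ : Cell → List ℕ → List ℕ → Cell → Set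
x <[ la , mu ] y = TransClosure (Covers la mu) x y

-- Colorings: true = white, false = black.
Coloring : Set
Coloring = Cell → Bool

BlockingTriple : List ℕ → List ℕ → Coloring → Cell → Cell → Cell → Set
BlockingTriple la mu col x y z =
  Covers la mu x y × Covers la mu y z × (col x ≡ col y) × (col z ≢ col y)

NoBlockingTriples : List ℕ → List ℕ → Coloring → Set
NoBlockingTriples la mu col = ∀ x y z → ¬ BlockingTriple la mu col x y z

-- A position is the list of remaining elements (a subset of the diagram).
Position : Set
Position = List Cell

MaximalIn : List ℕ → List ℕ → Cell → Position → Set
MaximalIn la mu e S = ∀ f → f ∈ S → ¬ (e <[ la , mu ] f)

MinimalIn : List ℕ → List ℕ → Cell → Position → Set
MinimalIn la mu e S = ∀ f → f ∈ S → ¬ (f <[ la , mu ] e)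

Removable : List ℕ → List ℕ → Cell → Position → Set
Removable la mu e S = e ∈ S × (MaximalIn la mu e S Data.Sum.⊎ MinimalIn la mu e S)
  where import Data.Sum

_≟c_ : (x y : Cell) → Relation.Nullary.Dec (x ≡ y)
_≟c_ = ≡-dec _≟ℕ_ _≟ℕ_
  where import Relation.Nullary

remove : Cell → Position → Position
remove e S = filter (λ f → ¬? (f ≟c e)) S

countColor : Coloring → Bool → Position → ℕ
countColor col c S = length (filter (λ f → col f ≟ᵇ c) S)

-- Balanced positions (inductively; positions are finite so this is the
-- intended recursive definition).
-- (i) every position reachable in one move (removing a removable element of
--     either color) is balanced;
-- (ii) if all removable elements have color c, at least half of the elements
--     have color c.
data Balanced (la mu : List ℕ) (col : Coloring) (S : Position) : Set where
  balanced :
    (∀ e → Removable la mu e S → Balanced la mu col (remove e S)) →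
    (∀ c → (∀ e → Removable la mu e S → col e ≡ c) →
       length S ≤ 2 * countColor col c S) →
    Balanced la mu col S

-- Every position reachable from the full diagram is a convex subset S of the skew
-- diagram, so it suffices to check condition (ii) for convex S.  Suppose every
-- removable cell of S has colour c, and call the other cells of S minority cells.
-- A minority cell is neither maximal nor minimal, so it has an upper cover in S;
-- with no blocking triples, a monochromatic cover x ⋖ z with z a minority cell would
-- then climb for ever, so every neighbour of a minority cell has colour c.  Sending a
-- minority cell to its left neighbour, or (for the first cell of its row in S) to
-- the end of its row or the cell just below that end, injects the minority cells
-- into the cells of colour c.

module Submission where

open import Defs
open import Level using (Level)
open import Function using (_∘_; case_of_)
open import Data.Nat using (ℕ; zero; suc; _+_; _*_; _∸_; _≤_; _<_; z≤n; s≤s)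
open import Data.Nat.Properties
open import Data.Nat.Induction using (<-wellFounded)
open import Data.Bool using (Bool)
open import Data.Bool.Properties using (¬-not) renaming (_≟_ to _≟ᵇ_)
open import Data.Product using (_×_; _,_; ∃-syntax; proj₁; proj₂)
open import Data.Sum using (_⊎_; inj₁; inj₂)
open import Data.Empty using (⊥; ⊥-elim)
open import Data.List using (List; []; _∷_; length; map; upTo; filter)
open import Data.List.Membership.Propositional using (_∈_; _∉_; find; lose)
open import Data.List.Membership.Propositional.Properties
  using (∈-map⁺; ∈-map⁻; ∈-upTo⁺; ∈-upTo⁻; ∈-concatMap⁺; ∈-concatMap⁻; ∈-filter⁺; ∈-filter⁻)
open import Data.List.Membership.DecPropositional _≟c_ using (_∈?_)
open import Data.List.Properties using (filter-notAll)
open import Data.List.Relation.Unary.Any as Any using (any?)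
import Data.List.Relation.Unary.All as All
import Data.List.Relation.Unary.All.Properties as All
import Data.List.Relation.Unary.AllPairs as AllPairs
import Data.List.Relation.Unary.AllPairs.Properties as AllPairs
open import Data.List.Relation.Unary.Unique.Propositional using (Unique)
import Data.List.Relation.Unary.Unique.Propositional.Properties as Unique
open import Induction.WellFounded using (Acc; acc)
open import Relation.Binary.Core using (Rel)
open import Relation.Binary.Definitions using (DecidableEquality)
open import Relation.Binary.Construct.Closure.Transitive using (TransClosure; [_]; _∷_; _∷ʳ_)
open import Relation.Binary.PropositionalEquality using (_≡_; _≢_; refl; sym; trans; cong; subst)
open import Relation.Nullary using (¬_; Dec; yes; no)
open import Relation.Nullary.Decidable using (¬?)
open import Relation.Unary using (Pred; Decidable)
open import Relation.Unary.Properties using (∁?)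

private
  variable
    a p r : Level
    A : Set a

length-filter-∁ : {P : Pred A p} (P? : Decidable P) (xs : List A) →
                  length xs ≡ length (filter P? xs) + length (filter (∁? P?) xs)
length-filter-∁ P? [] = refl
length-filter-∁ P? (x ∷ xs) with P? x
... | yes _ = cong suc (length-filter-∁ P? xs)
... | no _  = trans (cong suc (length-filter-∁ P? xs)) (sym (+-suc _ _))

length-≤-by-injection : DecidableEquality A → (R : Rel A r) (xs ys : List A) → Unique xs →
                        (∀ {x} → x ∈ xs → ∃[ y ] y ∈ ys × R x y) →
                        (∀ {x x′ y} → x ∈ xs → x′ ∈ xs → R x y → R x′ y → x ≡ x′) →
                        length xs ≤ length ys
length-≤-by-injection _≟_ R [] ys _ _ _ = z≤n
length-≤-by-injection _≟_ R (x ∷ xs) ys (x∉xs AllPairs.∷ uxs) image injective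
  with image (Any.here refl)
... | y , y∈ys , xRy = ≤-trans (s≤s (length-≤-by-injection _≟_ R xs ys⁻ uxs image⁻ injective⁻))
                               (filter-notAll ≢y? ys (lose y∈ys λ y≢y → y≢y refl))
  where
  ≢y? : Decidable (λ z → ¬ z ≡ y)
  ≢y? z = ¬? (z ≟ y)
  ys⁻ : List _
  ys⁻ = filter ≢y? ys
  image⁻ : ∀ {x′} → x′ ∈ xs → ∃[ y′ ] y′ ∈ ys⁻ × R x′ y′
  image⁻ x′∈xs with image (Any.there x′∈xs)
  ... | y′ , y′∈ys , x′Ry′ = y′ , ∈-filter⁺ ≢y? y′∈ys y′≢y , x′Ry′
    where
    y′≢y : ¬ y′ ≡ y
    y′≢y refl = All.lookup x∉xs x′∈xs (injective (Any.here refl) (Any.there x′∈xs) xRy x′Ry′)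
  injective⁻ : ∀ {x₁ x₂ y′} → x₁ ∈ xs → x₂ ∈ xs → R x₁ y′ → R x₂ y′ → x₁ ≡ x₂
  injective⁻ x₁∈ x₂∈ = injective (Any.there x₁∈) (Any.there x₂∈)

unsnoc : {R : Rel A r} {x z : A} → TransClosure R x z →
         R x z ⊎ ∃[ y ] TransClosure R x y × R y z
unsnoc [ xRz ] = inj₁ xRz
unsnoc (xRy ∷ y<z) with unsnoc y<z
... | inj₁ yRz              = inj₂ (_ , [ xRy ] , yRz)
... | inj₂ (w , y<w , wRz) = inj₂ (w , xRy ∷ y<w , wRz)

both-≢⇒≡ : ∀ {a b c : Bool} → a ≢ c → b ≢ c → a ≡ b
both-≢⇒≡ a≢c b≢c = trans (¬-not a≢c) (sym (¬-not b≢c))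

row-antitone : ∀ la → IsPartition la → ∀ {i k} → i ≤ k → row la k ≤ row la i
row-antitone la pla {i} {zero}  z≤n = ≤-refl
row-antitone la pla {i} {suc k} i≤k with m≤n⇒m<n∨m≡n i≤k
... | inj₁ i<k  = ≤-trans (pla k) (row-antitone la pla (≤-pred i<k))
... | inj₂ refl = ≤-refl

index<length : ∀ la i {j} → j < row la i → i < length la
index<length (_ ∷ _)  zero    _ = s≤s z≤n
index<length (_ ∷ la) (suc i) h = s≤s (index<length la i h)

∈-range⁺ : ∀ {m n j} → m ≤ j → j < n → j ∈ range m n
∈-range⁺ {m} {n} m≤j j<n =
  subst (_∈ range m n) (m+[n∸m]≡n m≤j) (∈-map⁺ (m +_) (∈-upTo⁺ (∸-monoˡ-< j<n m≤j)))

∈-range⁻ : ∀ {m n j} → j ∈ range m n → m ≤ j × j < n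
∈-range⁻ {m} {n} j∈ with ∈-map⁻ (m +_) j∈
... | t , t∈ , refl = m≤m+n m t , m+t<n
  where
  t<n∸m : t < n ∸ m
  t<n∸m = ∈-upTo⁻ t∈
  m+t<n : m + t < n
  m+t<n = subst (m + t <_) (m+[n∸m]≡n m≤n) (+-monoʳ-< m t<n∸m)
    where
    m≤n : m ≤ n
    m≤n = <⇒≤ (m∸n≢0⇒n<m λ n∸m≡0 → n≮0 (subst (t <_) n∸m≡0 t<n∸m))

rowCells : List ℕ → List ℕ → ℕ → List Cell
rowCells la mu i = map (i ,_) (range (row mu i) (row la i))

∈-skewCells⁺ : ∀ la mu {x} → InSkew la mu x → x ∈ skewCells la mu
∈-skewCells⁺ la mu {i , j} (mu≤j , j<la) =
  ∈-concatMap⁺ (rowCells la mu)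
    (Any.map (λ { refl → ∈-map⁺ (i ,_) (∈-range⁺ mu≤j j<la) }) (∈-upTo⁺ (index<length la i j<la)))

∈-skewCells⁻ : ∀ la mu {x} → x ∈ skewCells la mu → InSkew la mu x
∈-skewCells⁻ la mu x∈ with find (∈-concatMap⁻ (rowCells la mu) {xs = upTo (length la)} x∈)
... | i , _ , x∈row with ∈-map⁻ (i ,_) x∈row
... | j , j∈ , refl = ∈-range⁻ j∈

skewCells-unique : ∀ la mu → Unique (skewCells la mu)
skewCells-unique la mu = Unique.concat⁺ rows-unique rows-disjoint
  where
  rows-unique : All.All Unique (map (rowCells la mu) (upTo (length la)))
  rows-unique = All.map⁺ (All.tabulate λ {i} _ →
    Unique.map⁺ (λ { refl → refl }) (Unique.map⁺ (+-cancelˡ-≡ (row mu i) _ _) (Unique.upTo⁺ _)))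
  same-row : ∀ {i k x} → x ∈ rowCells la mu i → x ∈ rowCells la mu k → i ≡ k
  same-row {i} {k} x∈i x∈k with ∈-map⁻ (i ,_) x∈i | ∈-map⁻ (k ,_) x∈k
  ... | _ , _ , refl | _ , _ , refl = refl
  rows-disjoint : AllPairs.AllPairs _ (map (rowCells la mu) (upTo (length la)))
  rows-disjoint = AllPairs.map⁺
    (AllPairs.map (λ i≢k {_} (x∈i , x∈k) → i≢k (same-row x∈i x∈k)) (Unique.upTo⁺ (length la)))

adj? : (x y : Cell) → Dec (Adj x y)
adj? (i , j) y with (i , suc j) ≟c y | (suc i , j) ≟c y
... | yes refl | _        = yes (left i j)
... | no _     | yes refl = yes (above i j)
... | no ¬left | no ¬above = no λ { (left _ _) → ¬left refl ; (above _ _) → ¬above refl }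

rank : Cell → ℕ
rank (i , j) = i + j

rank-Adj : ∀ {x y} → Adj x y → rank y ≡ suc (rank x)
rank-Adj (left i j)  = +-suc i j
rank-Adj (above i j) = refl

module SkewPoset (la mu : List ℕ) where

  _<P_ : Rel Cell _
  x <P y = x <[ la , mu ] y

  Inside : Position → Set
  Inside S = ∀ {x} → x ∈ S → InSkew la mu x

  Convex : Position → Set
  Convex S = ∀ {x y z} → x ∈ S → z ∈ S → x <P y → y <P z → y ∈ S

  <-inSkewʳ : ∀ {x y} → x <P y → InSkew la mu y
  <-inSkewʳ [ (_ , y∈ , _) ] = y∈
  <-inSkewʳ (_ ∷ y<z)       = <-inSkewʳ y<z

  skewCells-convex : Convex (skewCells la mu)
  skewCells-convex _ _ x<y _ = ∈-skewCells⁺ la mu (<-inSkewʳ x<y)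

  row-< : ∀ {i j k} → InSkew la mu (i , j) → InSkew la mu (i , k) → j < k → (i , j) <P (i , k)
  row-< {i} {j} {suc k} ij ik (s≤s j≤k) with m≤n⇒m<n∨m≡n j≤k
  ... | inj₂ refl = [ (ij , ik , left i j) ]
  ... | inj₁ j<k  = row-< ij ik′ j<k ∷ʳ (ik′ , ik , left i k)
    where
    ik′ : InSkew la mu (i , k)
    ik′ = ≤-trans (proj₁ ij) j≤k , <-trans (n<1+n k) (proj₂ ik)

  convex-row : ∀ {S} → Inside S → Convex S → ∀ {i j k l} → (i , j) ∈ S → (i , l) ∈ S →
               j ≤ k → k ≤ l → (i , k) ∈ S
  convex-row ins cvx {i} {j} {k} {l} j∈S l∈S j≤k k≤l
    with m≤n⇒m<n∨m≡n j≤k | m≤n⇒m<n∨m≡n k≤l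
  ... | inj₂ refl | _         = j∈S
  ... | inj₁ _    | inj₂ refl = l∈S
  ... | inj₁ j<k  | inj₁ k<l  = cvx j∈S l∈S (row-< (ins j∈S) ik j<k) (row-< ik (ins l∈S) k<l)
    where
    ik : InSkew la mu (i , k)
    ik = ≤-trans (proj₁ (ins j∈S)) j≤k , ≤-<-trans k≤l (proj₂ (ins l∈S))

  maximal-if-no-upper-neighbour : ∀ {S y} → Convex S → y ∈ S →
                                  (∀ {u} → Adj y u → u ∉ S) → MaximalIn la mu y S
  maximal-if-no-upper-neighbour cvx y∈S none f f∈S [ (_ , _ , adj) ] = none adj f∈S
  maximal-if-no-upper-neighbour cvx y∈S none f f∈S (y⋖u ∷ u<f) =
    none (proj₂ (proj₂ y⋖u)) (cvx y∈S f∈S [ y⋖u ] u<f)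

  minimal-if-no-lower-neighbour : ∀ {S y} → Convex S → y ∈ S →
                                  (∀ {u} → Adj u y → u ∉ S) → MinimalIn la mu y S
  minimal-if-no-lower-neighbour cvx y∈S none f f∈S f<y with unsnoc f<y
  ... | inj₁ (_ , _ , adj)      = none adj f∈S
  ... | inj₂ (u , f<u , u⋖y) = none (proj₂ (proj₂ u⋖y)) (cvx f∈S y∈S f<u [ u⋖y ])

  non-maximal⇒upper-cover : ∀ {S y} → Inside S → Convex S → y ∈ S → ¬ MaximalIn la mu y S →
                            ∃[ z ] z ∈ S × Covers la mu y z
  non-maximal⇒upper-cover {S} {y} ins cvx y∈S ¬max with any? (adj? y) S
  ... | yes some = let z , z∈S , adj = find some in z , z∈S , ins y∈S , ins z∈S , adj
  ... | no none  =
    ⊥-elim (¬max (maximal-if-no-upper-neighbour cvx y∈S λ adj z∈S → none (lose z∈S adj)))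

  non-minimal⇒lower-cover : ∀ {S y} → Inside S → Convex S → y ∈ S → ¬ MinimalIn la mu y S →
                            ∃[ x ] x ∈ S × Covers la mu x y
  non-minimal⇒lower-cover {S} {y} ins cvx y∈S ¬min with any? (λ x → adj? x y) S
  ... | yes some = let x , x∈S , adj = find some in x , x∈S , ins x∈S , ins y∈S , adj
  ... | no none  =
    ⊥-elim (¬min (minimal-if-no-lower-neighbour cvx y∈S λ adj x∈S → none (lose x∈S adj)))

  rankCeiling : ℕ
  rankCeiling = length la + row la 0

  rank<rankCeiling : IsPartition la → ∀ {x} → InSkew la mu x → rank x < rankCeiling
  rank<rankCeiling pla {i , j} (_ , j<row) =
    +-mono-<-≤ (index<length la i j<row) (<⇒≤ (<-≤-trans j<row (row-antitone la pla z≤n)))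

  module Minority (pla : IsPartition la) (pmu : IsPartition mu)
                  (col : Coloring) (no-blocking : NoBlockingTriples la mu col)
                  {S : Position} (ins : Inside S) (cvx : Convex S)
                  (c : Bool) (removable-c : ∀ e → Removable la mu e S → col e ≡ c) where

    non-maximal : ∀ {y} → y ∈ S → col y ≢ c → ¬ MaximalIn la mu y S
    non-maximal y∈S y≢c max = y≢c (removable-c _ (y∈S , inj₁ max))

    non-minimal : ∀ {y} → y ∈ S → col y ≢ c → ¬ MinimalIn la mu y S
    non-minimal y∈S y≢c min = y≢c (removable-c _ (y∈S , inj₂ min))

    -- z is not removable, so it has an upper cover z′ in S; as x ⋖ z ⋖ z′ is not
    -- blocking, z ⋖ z′ is again monochromatic, one rank higher.
    no-monochrome-cover : ∀ {x z} → x ∈ S → z ∈ S → Covers la mu x z → col z ≢ c → col x ≢ col z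
    no-monochrome-cover {z = z} = climb rankCeiling (m≤n+m rankCeiling (rank z))
      where
      climb : ∀ n {x z} → rankCeiling ≤ rank z + n → x ∈ S → z ∈ S → Covers la mu x z →
              col z ≢ c → col x ≢ col z
      climb zero {z = z} bound _ z∈S _ _ _ =
        <⇒≱ (rank<rankCeiling pla (ins z∈S)) (subst (rankCeiling ≤_) (+-identityʳ (rank z)) bound)
      climb (suc n) {x} {z} bound x∈S z∈S x⋖z z≢c x≡z
        with non-maximal⇒upper-cover ins cvx z∈S (non-maximal z∈S z≢c)
      ... | z′ , z′∈S , z⋖z′ = climb n bound′ z∈S z′∈S z⋖z′ (z≢c ∘ trans z≡z′) z≡z′
        where
        z≡z′ : col z ≡ col z′
        z≡z′ with col z′ ≟ᵇ col z
        ... | yes z′≡z = sym z′≡z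
        ... | no  z′≢z = ⊥-elim (no-blocking x z z′ (x⋖z , z⋖z′ , x≡z , z′≢z))
        bound′ : rankCeiling ≤ rank z′ + n
        bound′ = subst (rankCeiling ≤_)
          (trans (+-suc (rank z) n) (cong (_+ n) (sym (rank-Adj (proj₂ (proj₂ z⋖z′)))))) bound

    lower-neighbour-is-c : ∀ {x y} → x ∈ S → y ∈ S → Covers la mu x y → col y ≢ c → col x ≡ c
    lower-neighbour-is-c {x} x∈S y∈S x⋖y y≢c with col x ≟ᵇ c
    ... | yes x≡c = x≡c
    ... | no  x≢c = ⊥-elim (no-monochrome-cover x∈S y∈S x⋖y y≢c (both-≢⇒≡ x≢c y≢c))

    upper-neighbour-is-c : ∀ {y z} → y ∈ S → z ∈ S → Covers la mu y z → col y ≢ c → col z ≡ c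
    upper-neighbour-is-c {z = z} y∈S z∈S y⋖z y≢c with col z ≟ᵇ c
    ... | yes z≡c = z≡c
    ... | no  z≢c = ⊥-elim (no-monochrome-cover y∈S z∈S y⋖z z≢c (both-≢⇒≡ y≢c z≢c))

    RowStart : Cell → Set
    RowStart (i , j) = ∀ {k} → j ≡ suc k → (i , k) ∉ S

    RowEnd : Cell → Set
    RowEnd (i , k) = (i , k) ∈ S × (i , suc k) ∉ S

    row-end : ∀ {i j} → (i , j) ∈ S → ∃[ k ] RowEnd (i , k)
    row-end {i} {j} j∈S = walk (row la i) j (m≤n+m (row la i) j) j∈S
      where
      walk : ∀ n j → row la i ≤ j + n → (i , j) ∈ S → ∃[ k ] RowEnd (i , k)
      walk zero j bound j∈S =
        ⊥-elim (<⇒≱ (proj₂ (ins j∈S)) (subst (row la i ≤_) (+-identityʳ j) bound))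
      walk (suc n) j bound j∈S with (i , suc j) ∈? S
      ... | no  next∉S = j , j∈S , next∉S
      ... | yes next∈S = walk n (suc j) (subst (row la i ≤_) (+-suc j n) bound) next∈S

    row-start-≤ : ∀ {i j k} → (i , j) ∈ S → (i , k) ∈ S → RowStart (i , j) → j ≤ k
    row-start-≤ {i} {j} {k} j∈S k∈S start with j ≤? k
    ... | yes j≤k = j≤k
    ... | no  j≰k with ≰⇒> j≰k
    ... | s≤s {n = l} k≤l = ⊥-elim (start refl (convex-row ins cvx k∈S j∈S k≤l (n≤1+n l)))

    row-start-unique : ∀ {i j k} → (i , j) ∈ S → (i , k) ∈ S → RowStart (i , j) → RowStart (i , k) →
                       j ≡ k
    row-start-unique j∈S k∈S j-start k-start =
      ≤-antisym (row-start-≤ j∈S k∈S j-start) (row-start-≤ k∈S j∈S k-start)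

    below-right-of-row-end : ∀ {i k} → RowEnd (i , k) → (suc i , suc k) ∉ S
    below-right-of-row-end {i} {k} (k∈S , next∉S) below∈S =
      next∉S (cvx k∈S below∈S [ (ins k∈S , next , left i k) ]
                              [ (next , ins below∈S , above i (suc k)) ])
      where
      next : InSkew la mu (i , suc k)
      next = ≤-trans (proj₁ (ins k∈S)) (n≤1+n k) , <-≤-trans (proj₂ (ins below∈S)) (pla i)

    -- The lower row start (i+1 , j) has its lower cover (i , j) in S, so k ≤ j;
    -- convexity rules out k < j, and k = j gives two adjacent minority cells.
    row-starts-not-both-minority : ∀ {i j k} →
      (suc i , j) ∈ S → RowStart (suc i , j) → col (suc i , j) ≢ c →
      (i , k) ∈ S → RowStart (i , k) → col (i , k) ≢ c → ⊥
    row-starts-not-both-minority {i} {j} {k} j∈S j-start j≢c k∈S k-start k≢c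
      with non-minimal⇒lower-cover ins cvx j∈S (non-minimal j∈S j≢c)
    ... | _ , x∈S , (_ , _ , left _ _)  = j-start refl x∈S
    ... | _ , x∈S , (_ , _ , above _ _) with m≤n⇒m<n∨m≡n (row-start-≤ k∈S x∈S k-start)
    ...   | inj₂ refl = k≢c (lower-neighbour-is-c k∈S j∈S (ins k∈S , ins j∈S , above i j) j≢c)
    ...   | inj₁ k<j  = <⇒≱ k<j (row-start-≤ j∈S below-k∈S j-start)
      where
      below-k : InSkew la mu (suc i , k)
      below-k = ≤-trans (pmu i) (proj₁ (ins k∈S)) , <-trans k<j (proj₂ (ins j∈S))
      below-k∈S : (suc i , k) ∈ S
      below-k∈S = cvx k∈S j∈S [ (ins k∈S , below-k , above i k) ] (row-< below-k (ins j∈S) k<j)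

    data Partner : Cell → Cell → Set where
      left-neighbour : ∀ {i j} → (i , j) ∈ S → Partner (i , suc j) (i , j)
      row-end-c      : ∀ {i j k} → RowStart (i , j) → RowEnd (i , k) → col (i , k) ≡ c →
                       Partner (i , j) (i , k)
      below-row-end  : ∀ {i j k} → RowStart (i , j) → RowEnd (i , k) → col (i , k) ≢ c →
                       Partner (i , j) (suc i , k)

    partner-of-row-start : ∀ {i j} → (i , j) ∈ S → RowStart (i , j) → ∃[ w ] Partner (i , j) w
    partner-of-row-start j∈S start with row-end j∈S
    ... | k , end with col (_ , k) ≟ᵇ c
    ...   | yes k≡c = _ , row-end-c start end k≡c
    ...   | no  k≢c = _ , below-row-end start end k≢c

    partner : ∀ {y} → y ∈ S → ∃[ w ] Partner y w
    partner {i , zero} y∈S = partner-of-row-start y∈S λ ()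
    partner {i , suc j} y∈S with (i , j) ∈? S
    ... | yes left∈S = _ , left-neighbour left∈S
    ... | no  left∉S = partner-of-row-start y∈S λ { refl → left∉S }

    -- A minority row end is not maximal and has nothing to its right, so its upper
    -- cover lies below it.
    partner-is-c : ∀ {y w} → y ∈ S → col y ≢ c → Partner y w → w ∈ S × col w ≡ c
    partner-is-c y∈S y≢c (left-neighbour {i} {j} left∈S) =
      left∈S , lower-neighbour-is-c left∈S y∈S (ins left∈S , ins y∈S , left i j) y≢c
    partner-is-c y∈S y≢c (row-end-c _ (k∈S , _) k≡c) = k∈S , k≡c
    partner-is-c y∈S y≢c (below-row-end _ (k∈S , next∉S) k≢c)
      with non-maximal⇒upper-cover ins cvx k∈S (non-maximal k∈S k≢c)
    ... | _ , z∈S , (_ , _ , left _ _)         = ⊥-elim (next∉S z∈S)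
    ... | _ , z∈S , k⋖z@(_ , _ , above _ _) = z∈S , upper-neighbour-is-c k∈S z∈S k⋖z k≢c

    partner-injective : ∀ {y y′ w} → y ∈ S → y′ ∈ S → col y ≢ c → col y′ ≢ c →
                        Partner y w → Partner y′ w → y ≡ y′
    partner-injective y∈S y′∈S y≢c y′≢c = λ where
      (left-neighbour _) (left-neighbour _) → refl
      (left-neighbour _) (row-end-c _ (_ , next∉S) _) → ⊥-elim (next∉S y∈S)
      (left-neighbour _) (below-row-end _ end _) → ⊥-elim (below-right-of-row-end end y∈S)
      (row-end-c _ (_ , next∉S) _) (left-neighbour _) → ⊥-elim (next∉S y′∈S)
      (row-end-c start _ _) (row-end-c start′ _ _) →
        cong (_ ,_) (row-start-unique y∈S y′∈S start start′)
      (row-end-c start _ _) (below-row-end start′ _ _) →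
        ⊥-elim (row-starts-not-both-minority y∈S start y≢c y′∈S start′ y′≢c)
      (below-row-end _ end _) (left-neighbour _) → ⊥-elim (below-right-of-row-end end y′∈S)
      (below-row-end start _ _) (row-end-c start′ _ _) →
        ⊥-elim (row-starts-not-both-minority y′∈S start′ y′≢c y∈S start y≢c)
      (below-row-end start _ _) (below-row-end start′ _ _) →
        cong (_ ,_) (row-start-unique y∈S y′∈S start start′)

    IsC? : Decidable (λ f → col f ≡ c)
    IsC? f = col f ≟ᵇ c

    minority≤majority : Unique S → length (filter (∁? IsC?) S) ≤ length (filter IsC? S)
    minority≤majority uS =
      length-≤-by-injection _≟c_ Partner _ _ (Unique.filter⁺ (∁? IsC?) uS) image injective
      where
      image : ∀ {y} → y ∈ filter (∁? IsC?) S → ∃[ w ] w ∈ filter IsC? S × Partner y w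
      image y∈ with ∈-filter⁻ (∁? IsC?) {xs = S} y∈
      ... | y∈S , y≢c with partner y∈S
      ...   | w , yPw with partner-is-c y∈S y≢c yPw
      ...     | w∈S , w≡c = w , ∈-filter⁺ IsC? w∈S w≡c , yPw
      injective : ∀ {y y′ w} → y ∈ filter (∁? IsC?) S → y′ ∈ filter (∁? IsC?) S →
                  Partner y w → Partner y′ w → y ≡ y′
      injective y∈ y′∈ =
        let y∈S , y≢c = ∈-filter⁻ (∁? IsC?) {xs = S} y∈
            y′∈S , y′≢c = ∈-filter⁻ (∁? IsC?) {xs = S} y′∈
        in partner-injective y∈S y′∈S y≢c y′≢c

    at-least-half-c : Unique S → length S ≤ 2 * countColor col c S
    at-least-half-c uS = begin
      length S                         ≡⟨ length-filter-∁ IsC? S ⟩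
      majority + length (filter (∁? IsC?) S) ≤⟨ +-monoʳ-≤ majority (minority≤majority uS) ⟩
      majority + majority              ≡⟨ cong (majority +_) (sym (+-identityʳ majority)) ⟩
      2 * countColor col c S           ∎
      where
      open ≤-Reasoning
      majority : ℕ
      majority = countColor col c S

  ConvexPosition : Position → Set
  ConvexPosition S = Unique S × Inside S × Convex S

  module _ {S : Position} {e : Cell} where

    private
      ≢e? : Decidable (λ f → ¬ f ≡ e)
      ≢e? f = ¬? (f ≟c e)

    remove-shrinks : e ∈ S → length (remove e S) < length S
    remove-shrinks e∈S = filter-notAll ≢e? S (lose e∈S λ e≢e → e≢e refl)

    remove-convex : ConvexPosition S → Removable la mu e S → ConvexPosition (remove e S)
    remove-convex (uS , ins , cvx) (_ , extremal) =
      Unique.filter⁺ ≢e? uS , (λ f∈ → ins (∈S f∈)) , convex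
      where
      ∈S : ∀ {f} → f ∈ remove e S → f ∈ S
      ∈S f∈ = proj₁ (∈-filter⁻ ≢e? {xs = S} f∈)
      convex : Convex (remove e S)
      convex {x} {y} {z} x∈ z∈ x<y y<z = ∈-filter⁺ ≢e? (cvx (∈S x∈) (∈S z∈) x<y y<z) y≢e
        where
        y≢e : ¬ y ≡ e
        y≢e refl = case extremal of λ where
          (inj₁ maximal) → maximal z (∈S z∈) y<z
          (inj₂ minimal) → minimal x (∈S x∈) x<y

  convex-balanced : IsPartition la → IsPartition mu → (col : Coloring) → NoBlockingTriples la mu col →
                    ∀ {S} → ConvexPosition S → Balanced la mu col S
  convex-balanced pla pmu col no-blocking {S} = go (<-wellFounded (length S))
    where
    go : ∀ {S} → Acc _<_ (length S) → ConvexPosition S → Balanced la mu col S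
    go (acc smaller) pos@(uS , ins , cvx) = balanced
      (λ e removable →
        go (smaller (remove-shrinks (proj₁ removable))) (remove-convex pos removable))
      (λ c removable-c → Minority.at-least-half-c pla pmu col no-blocking ins cvx c removable-c uS)

mainTheorem9 : (la mu : List ℕ) → IsPartition la → IsPartition mu → mu ⊆Y la →
    (col : Coloring) → NoBlockingTriples la mu col →
    Balanced la mu col (skewCells la mu)
mainTheorem9 la mu pla pmu _ col no-blocking =
  convex-balanced pla pmu col no-blocking
    (skewCells-unique la mu , ∈-skewCells⁻ la mu , skewCells-convex)
  where open SkewPoset la mu
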